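{- Let $k\ge 1$. A word $w$ over a totally ordered alphabet is sortable by a pop stack of depth $k$ if and only if $w$ avoids each of the patterns $120$, $201$, $1010$, and $k(k-1)\cdots 10$ (the strictly decreasing pattern of length $k+1$).
   Context: A word $w=w_1\cdots w_n$ contains a pattern $p=p_1\cdots p_m$ if there are indices $\alpha_1<\cdots<\alpha_m$ with $w_{\alpha_i}<w_{\alpha_j}$ iff $p_i<p_j$ and $w_{\alpha_i}=w_{\alpha_j}$ iff $p_i=p_j$; otherwise $w$ avoids $p$. A pop stack is a stack (entries read left to right; a push moves the next input entry onto the top of the stack) in which every pop operation empties the whole stack, moving all its entries to the end of the output from top to bottom. A pop stack of depth $k$ is a pop stack whose contents may, at every stage, contain entries of at most $k$ distinct values (arbitrarily many entries of equal value are allowed). A word is sortable by such a device if some admissible sequence of pushes and pops outputs all its entries in weakly increasing order. -}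

module Defs where

open import Level using (_⊔_)
open import Data.Nat as ℕ using (ℕ; zero; suc)
open import Data.Fin as Fin using (Fin)
open import Data.List using (List; []; _∷_; length; lookup; _++_)
open import Data.List.Relation.Unary.All using (All)
open import Data.List.Relation.Unary.Any using (Any)
open import Data.List.Relation.Unary.Linked using (Linked)
open import Data.Product using (Σ; _×_)
open import Data.Sum using (_⊎_)
open import Relation.Nullary using (¬_)
open import Relation.Binary.PropositionalEquality using (_≡_)
open import Relation.Binary.Bundles using (StrictTotalOrder)
open import Function.Bundles using (_⇔_)

decPat : ℕ → List ℕ
decPat zero    = 0 ∷ []
decPat (suc k) = suc k ∷ decPat k

module PopStack {a ℓ₁ ℓ₂} (O : StrictTotalOrder a ℓ₁ ℓ₂) where
  open StrictTotalOrder O renaming (Carrier to C)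

  Word : Set a
  Word = List C

  Contains : Word → List ℕ → Set (ℓ₁ ⊔ ℓ₂)
  Contains w p =
    Σ (Fin (length p) → Fin (length w)) λ α →
      (∀ i j → i Fin.< j → α i Fin.< α j)
      × (∀ i j → (lookup w (α i) < lookup w (α j)) ⇔ (lookup p i ℕ.< lookup p j))
      × (∀ i j → (lookup w (α i) ≈ lookup w (α j)) ⇔ (lookup p i ≡ lookup p j))

  Avoids : Word → List ℕ → Set (ℓ₁ ⊔ ℓ₂)
  Avoids w p = ¬ Contains w p

  _≼_ : C → C → Set (ℓ₁ ⊔ ℓ₂)
  x ≼ y = (x < y) ⊎ (x ≈ y)

  WeaklyIncreasing : Word → Set (a ⊔ ℓ₁ ⊔ ℓ₂)
  WeaklyIncreasing = Linked _≼_

  AtMostDistinct : ℕ → List C → Set (a ⊔ ℓ₁)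
  AtMostDistinct k st = Σ (List C) λ R → (length R ℕ.≤ k) × All (λ x → Any (x ≈_) R) st

  -- Sorts k input stack output : from this configuration (stack listed
  -- top first, output so far), some admissible sequence of pushes and pops
  -- ends with everything output in weakly increasing order.
  data Sorts (k : ℕ) : Word → List C → Word → Set (a ⊔ ℓ₁ ⊔ ℓ₂) where
    done : ∀ {out} → WeaklyIncreasing out → Sorts k [] [] out
    push : ∀ {x inp st out} → AtMostDistinct k (x ∷ st) →
           Sorts k inp (x ∷ st) out → Sorts k (x ∷ inp) st out
    pop  : ∀ {inp st out} →
           Sorts k inp [] (out ++ st) → Sorts k inp st out

  PopStackSortable : ℕ → Word → Set (a ⊔ ℓ₁ ⊔ ℓ₂)
  PopStackSortable k w = Sorts k w [] []

{-# OPTIONS --safe #-}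
-- Sortability passes to subwords, and no realisation of 120, 201 or 1010 can be sorted, while a
-- strictly decreasing word of length k + 1 must be pushed entirely before anything is popped,
-- which needs k + 1 distinct values in the stack. Conversely, if w avoids the four patterns, the
-- greedy strategy sorts it: push while the next entry is at most the top of the stack, pop
-- otherwise. The stack then holds a weakly decreasing subword of w, so it has at most k distinct
-- values; and when the next entry y exceeds the top b, an unread entry below a stack entry o
-- would form 120 (if o = b), 201 or 1010, so everything popped is below all unread entries.
module Submission where

open import Level using (Level; _⊔_)
open import Data.Empty using (⊥; ⊥-elim)
open import Data.Unit.Polymorphic using (⊤)
open import Data.Product using (Σ; _×_; _,_; proj₁; proj₂)
open import Data.Sum using (inj₁; inj₂)
open import Data.Nat as ℕ using (ℕ; zero; suc; _≤_; z≤n; s≤s)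
import Data.Nat.Properties as ℕ
open import Data.Fin as Fin using (Fin; #_; toℕ)
import Data.Fin.Properties as Fin
open import Data.Vec.Functional using () renaming (_∷_ to _∷ᶠ_)
open import Data.List using (List; []; _∷_; length; lookup; _++_; tabulate; _ʳ++_; reverse)
open import Data.List.Properties
  using (++-assoc; ++-identityʳ; length-tabulate; length-removeAt′; tabulate-cong; length-reverse)
open import Data.List.Membership.Propositional using (_∈_)
open import Data.List.Membership.Propositional.Properties using (∈-++⁺ˡ; ∈-++⁺ʳ)
open import Data.List.Relation.Unary.All as All using (All; []; _∷_)
import Data.List.Relation.Unary.All.Properties as All
open import Data.List.Relation.Unary.Any as Any using (Any; here; there; _─_)
open import Data.List.Relation.Unary.AllPairs as AllPairs using (AllPairs; []; _∷_)
import Data.List.Relation.Unary.AllPairs.Properties as AllPairs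
open import Data.List.Relation.Unary.Linked.Properties using (AllPairs⇒Linked; Linked⇒AllPairs)
open import Data.List.Relation.Binary.Sublist.Propositional
  using (_⊆_; []; _∷_; _∷ʳ_; minimum; from∈; ⊆-refl; ⊆-trans)
open import Data.List.Relation.Binary.Sublist.Propositional.Properties using (All-resp-⊆; ++⁺; ʳ++⁺)
open import Function.Base using (flip; _∘_)
open import Function.Bundles using (_⇔_; mk⇔; Equivalence)
open import Relation.Nullary using (¬_; contradiction; yes; no)
open import Relation.Binary.Core using (Rel)
open import Relation.Binary.Bundles using (Setoid; StrictTotalOrder; DecTotalOrder)
open import Relation.Binary.Definitions using (tri<; tri≈; tri>)
import Relation.Binary.Construct.StrictToNonStrict as NonStrict
import Relation.Binary.Properties.StrictTotalOrder as StrictTotalOrderProperties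
open import Relation.Binary.PropositionalEquality as ≡ using (_≡_; refl)

open import Defs

private
  variable
    a c p q r ℓ : Level

module _ {A : Set a} {R : Rel A r} where

  AllPairs-resp-⊆ : ∀ {xs ys} → xs ⊆ ys → AllPairs R ys → AllPairs R xs
  AllPairs-resp-⊆ []             []         = []
  AllPairs-resp-⊆ (_ ∷ʳ xs⊆ys)   (_ ∷ Rys)  = AllPairs-resp-⊆ xs⊆ys Rys
  AllPairs-resp-⊆ (refl ∷ xs⊆ys) (Rx ∷ Rys) = All-resp-⊆ xs⊆ys Rx ∷ AllPairs-resp-⊆ xs⊆ys Rys

  AllPairs-pair : ∀ {x y zs} → AllPairs R zs → x ∷ y ∷ [] ⊆ zs → R x y
  AllPairs-pair Rzs sub with (Rxy ∷ []) ∷ _ ← AllPairs-resp-⊆ sub Rzs = Rxy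

  AllPairs-ʳ++⁺ : ∀ {xs acc} → AllPairs R xs → AllPairs (flip R) acc →
                  All (λ y → All (R y) xs) acc → AllPairs (flip R) (xs ʳ++ acc)
  AllPairs-ʳ++⁺ []         Racc _        = Racc
  AllPairs-ʳ++⁺ (Rx ∷ Rxs) Racc acc-R-xs =
    AllPairs-ʳ++⁺ Rxs (All.map All.head acc-R-xs ∷ Racc) (Rx ∷ All.map All.tail acc-R-xs)

  AllPairs-reverse⁺ : ∀ {xs} → AllPairs R xs → AllPairs (flip R) (reverse xs)
  AllPairs-reverse⁺ Rxs = AllPairs-ʳ++⁺ Rxs [] []

module _ {A : Set a} {P : A → Set p} {Q : A → Set q} where

  Any-─ : ∀ {ys} (py : Any P ys) → Any Q ys → (∀ {z} → P z → ¬ Q z) → Any Q (ys ─ py)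
  Any-─ (here pz)  (here qz)  disjoint = contradiction qz (disjoint pz)
  Any-─ (here _)   (there qy) _        = qy
  Any-─ (there _)  (here qz)  _        = here qz
  Any-─ (there py) (there qy) disjoint = there (Any-─ py qy disjoint)

module _ (S : Setoid c ℓ) where
  open Setoid S

  pigeonhole : ∀ {xs ys} → AllPairs _≉_ xs → All (λ x → Any (x ≈_) ys) xs → length xs ≤ length ys
  pigeonhole []                 []             = z≤n
  pigeonhole {ys = ys} (x≉xs ∷ xs-distinct) (x∈ys ∷ xs∈ys) =
    ≡.subst (_ ≤_) (≡.sym (length-removeAt′ ys (Any.index x∈ys)))
      (s≤s (pigeonhole xs-distinct (All.zipWith still-covered (x≉xs , xs∈ys))))
    where
    still-covered : ∀ {y} → _ × Any (y ≈_) ys → Any (y ≈_) (ys ─ x∈ys)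
    still-covered (x≉y , y∈ys) = Any-─ x∈ys y∈ys (λ x≈z y≈z → x≉y (trans x≈z (sym y≈z)))

StrictlyIncreasing : ∀ {m n} → (Fin m → Fin n) → Set
StrictlyIncreasing α = ∀ i j → i Fin.< j → α i Fin.< α j

factor-through-suc : ∀ {m n} (α : Fin m → Fin (suc n)) → StrictlyIncreasing α →
                     (∀ i → 0 ℕ.< toℕ (α i)) →
                     Σ (Fin m → Fin n) λ β → StrictlyIncreasing β × (∀ i → α i ≡ Fin.suc (β i))
factor-through-suc α α↑ α>0 = β , β↑ , α≡suc∘β
  where
  β : _ → Fin _
  β i = Fin.punchOut {i = Fin.zero} (Fin.<⇒≢ (α>0 i))
  α≡suc∘β : ∀ i → α i ≡ Fin.suc (β i)
  α≡suc∘β i = ≡.sym (Fin.punchIn-punchOut {i = Fin.zero} (Fin.<⇒≢ (α>0 i)))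
  β↑ : StrictlyIncreasing β
  β↑ i j i<j = ℕ.s≤s⁻¹ (≡.subst₂ Fin._<_ (α≡suc∘β i) (α≡suc∘β j) (α↑ i j i<j))

module _ {A : Set a} where

  mutual
    tabulate-lookup-⊆ : ∀ (w : List A) {m} (α : Fin m → Fin (length w)) → StrictlyIncreasing α →
                        tabulate (lookup w ∘ α) ⊆ w
    tabulate-lookup-⊆ []      {zero}  α α↑ = []
    tabulate-lookup-⊆ []      {suc m} α α↑ with () ← α Fin.zero
    tabulate-lookup-⊆ (x ∷ w) {zero}  α α↑ = minimum _
    tabulate-lookup-⊆ (x ∷ w) {suc m} α α↑ with α Fin.zero Fin.≟ Fin.zero
    ... | yes α₀≡0 = ≡.cong (lookup (x ∷ w)) α₀≡0 ∷ tabulate-lookup-∷-⊆ x w (α ∘ Fin.suc) α∘suc↑ α∘suc>0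
      where
      α∘suc↑ : StrictlyIncreasing (α ∘ Fin.suc)
      α∘suc↑ i j i<j = α↑ (Fin.suc i) (Fin.suc j) (s≤s i<j)
      α∘suc>0 : ∀ i → 0 ℕ.< toℕ (α (Fin.suc i))
      α∘suc>0 i = ≡.subst (λ j → toℕ j ℕ.< toℕ (α (Fin.suc i))) α₀≡0 (α↑ Fin.zero (Fin.suc i) ℕ.z<s)
    ... | no α₀≢0 = x ∷ʳ tabulate-lookup-∷-⊆ x w α α↑ α>0
      where
      α>0 : ∀ i → 0 ℕ.< toℕ (α i)
      α>0 Fin.zero    = ℕ.n≢0⇒n>0 (α₀≢0 ∘ Fin.toℕ-injective)
      α>0 (Fin.suc i) = ℕ.<-trans (α>0 Fin.zero) (α↑ Fin.zero (Fin.suc i) ℕ.z<s)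

    tabulate-lookup-∷-⊆ : ∀ x (w : List A) {m} (α : Fin m → Fin (suc (length w))) →
                          StrictlyIncreasing α → (∀ i → 0 ℕ.< toℕ (α i)) →
                          tabulate (lookup (x ∷ w) ∘ α) ⊆ w
    tabulate-lookup-∷-⊆ x w α α↑ α>0 with β , β↑ , α≡suc∘β ← factor-through-suc α α↑ α>0 =
      ≡.subst (_⊆ w) (tabulate-cong (λ i → ≡.cong (lookup (x ∷ w)) (≡.sym (α≡suc∘β i))))
        (tabulate-lookup-⊆ w β β↑)

  tabulate-⊆⇒embedding : ∀ {m} (f : Fin m → A) {w} → tabulate f ⊆ w →
                         Σ (Fin m → Fin (length w)) λ α →
                           StrictlyIncreasing α × (∀ i → lookup w (α i) ≡ f i)
  tabulate-⊆⇒embedding {zero}  f sub = (λ ()) , (λ ()) , (λ ())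
  tabulate-⊆⇒embedding {suc m} f (_ ∷ʳ sub) with α , α↑ , α≗f ← tabulate-⊆⇒embedding f sub =
    Fin.suc ∘ α , (λ i j i<j → s≤s (α↑ i j i<j)) , α≗f
  tabulate-⊆⇒embedding {suc m} f {_ ∷ w} (refl ∷ sub)
    with α , α↑ , α≗f ← tabulate-⊆⇒embedding (f ∘ Fin.suc) sub = α′ , α′↑ , α′≗f
    where
    α′ : Fin (suc m) → Fin (suc (length w))
    α′ Fin.zero    = Fin.zero
    α′ (Fin.suc i) = Fin.suc (α i)
    α′↑ : StrictlyIncreasing α′
    α′↑ Fin.zero    (Fin.suc j) _   = ℕ.z<s
    α′↑ (Fin.suc i) (Fin.suc j) i<j = s≤s (α↑ i j (ℕ.s≤s⁻¹ i<j))
    α′≗f : ∀ i → lookup (f Fin.zero ∷ w) (α′ i) ≡ f i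
    α′≗f Fin.zero    = refl
    α′≗f (Fin.suc i) = α≗f i

lookup-decPat-≤ : ∀ k i → lookup (decPat k) i ≤ k
lookup-decPat-≤ zero    Fin.zero    = z≤n
lookup-decPat-≤ (suc k) Fin.zero    = ℕ.≤-refl
lookup-decPat-≤ (suc k) (Fin.suc i) = ℕ.m≤n⇒m≤1+n (lookup-decPat-≤ k i)

lookup-decPat-decreasing : ∀ k i j → i Fin.< j → lookup (decPat k) j ℕ.< lookup (decPat k) i
lookup-decPat-decreasing zero    Fin.zero    Fin.zero    ()
lookup-decPat-decreasing (suc k) Fin.zero    (Fin.suc j) _   = s≤s (lookup-decPat-≤ k j)
lookup-decPat-decreasing (suc k) (Fin.suc i) (Fin.suc j) i<j =
  lookup-decPat-decreasing k i j (ℕ.s≤s⁻¹ i<j)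

length-decPat : ∀ k → length (decPat k) ≡ suc k
length-decPat zero    = refl
length-decPat (suc k) = ≡.cong suc (length-decPat k)

module _ {a ℓ₁ ℓ₂} (O : StrictTotalOrder a ℓ₁ ℓ₂) where
  open PopStack O
  open StrictTotalOrder O renaming (Carrier to C)
  private
    module ≼ = DecTotalOrder (StrictTotalOrderProperties.decTotalOrder O)
    variable
      x y z o b : C
      k : ℕ
      w inp st out : Word

  <-≼-trans : x < y → y ≼ z → x < z
  <-≼-trans = NonStrict.<-≤-trans _≈_ _<_ trans (proj₁ <-resp-≈)

  ≼-<-trans : x ≼ y → y < z → x < z
  ≼-<-trans = NonStrict.≤-<-trans _≈_ _<_ Eq.sym trans (proj₂ <-resp-≈)

  ≼⇒≯ : x ≼ y → ¬ y < x
  ≼⇒≯ x≼y y<x = irrefl Eq.refl (≼-<-trans x≼y y<x)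

  ≮⇒≽ : ¬ x < y → y ≼ x
  ≮⇒≽ {x} {y} x≮y with compare x y
  ... | tri< x<y _ _ = contradiction x<y x≮y
  ... | tri≈ _ x≈y _ = inj₂ (Eq.sym x≈y)
  ... | tri> _ _ y<x = inj₁ y<x

  data SameOrder (x y : C) (m n : ℕ) : Set (ℓ₁ ⊔ ℓ₂) where
    both< : x < y → m ℕ.< n → SameOrder x y m n
    both≈ : x ≈ y → m ≡ n   → SameOrder x y m n
    both> : x > y → m ℕ.> n → SameOrder x y m n

  SameOrder-sym : ∀ {m n} → SameOrder x y m n → SameOrder y x n m
  SameOrder-sym (both< x<y m<n) = both> x<y m<n
  SameOrder-sym (both≈ x≈y m≡n) = both≈ (Eq.sym x≈y) (≡.sym m≡n)
  SameOrder-sym (both> x>y m>n) = both< x>y m>n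

  SameOrder⇒<⇔< : ∀ {m n} → SameOrder x y m n → (x < y) ⇔ (m ℕ.< n)
  SameOrder⇒<⇔< (both< x<y m<n) = mk⇔ (λ _ → m<n) (λ _ → x<y)
  SameOrder⇒<⇔< (both≈ x≈y m≡n) =
    mk⇔ (contradiction x≈y ∘ flip irrefl) (contradiction m≡n ∘ flip ℕ.<-irrefl)
  SameOrder⇒<⇔< (both> x>y m>n) = mk⇔ (contradiction x>y ∘ asym) (contradiction m>n ∘ ℕ.<-asym)

  SameOrder⇒≈⇔≡ : ∀ {m n} → SameOrder x y m n → (x ≈ y) ⇔ (m ≡ n)
  SameOrder⇒≈⇔≡ (both< x<y m<n) = mk⇔ (contradiction x<y ∘ irrefl) (contradiction m<n ∘ ℕ.<-irrefl)
  SameOrder⇒≈⇔≡ (both≈ x≈y m≡n) = mk⇔ (λ _ → m≡n) (λ _ → x≈y)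
  SameOrder⇒≈⇔≡ (both> x>y m>n) =
    mk⇔ (contradiction x>y ∘ irrefl ∘ Eq.sym) (contradiction m>n ∘ ℕ.<-irrefl ∘ ≡.sym)

  SameOrderType : ∀ {n} → (Fin n → C) → (Fin n → ℕ) → Set (ℓ₁ ⊔ ℓ₂)
  SameOrderType f g = (∀ i j → (f i < f j) ⇔ (g i ℕ.< g j)) × (∀ i j → (f i ≈ f j) ⇔ (g i ≡ g j))

  SameOrderType⇒< : ∀ {n} {f : Fin n → C} {g} → SameOrderType f g → ∀ i j → g i ℕ.< g j → f i < f j
  SameOrderType⇒< (same< , _) i j = Equivalence.from (same< i j)

  SameOrderType-resp-≗ : ∀ {n} {f f′ : Fin n → C} {g} → (∀ i → f i ≡ f′ i) →
                         SameOrderType f g → SameOrderType f′ g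
  SameOrderType-resp-≗ f≗f′ (same< , same≈) =
      (λ i j → ≡.subst₂ (λ u v → (u < v) ⇔ _) (f≗f′ i) (f≗f′ j) (same< i j))
    , (λ i j → ≡.subst₂ (λ u v → (u ≈ v) ⇔ _) (f≗f′ i) (f≗f′ j) (same≈ i j))

  -- Records only the pairs i < j, so that concrete instances are short to write down.
  OrderIsomorphic : (p : List ℕ) → (Fin (length p) → C) → Set (ℓ₁ ⊔ ℓ₂)
  OrderIsomorphic []      f = ⊤
  OrderIsomorphic (m ∷ p) f =
    (∀ j → SameOrder (f Fin.zero) (f (Fin.suc j)) m (lookup p j)) × OrderIsomorphic p (f ∘ Fin.suc)

  OrderIsomorphic⇒SameOrder : ∀ p {f} → OrderIsomorphic p f →
                              ∀ i j → SameOrder (f i) (f j) (lookup p i) (lookup p j)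
  OrderIsomorphic⇒SameOrder (m ∷ p) iso Fin.zero    Fin.zero    = both≈ Eq.refl refl
  OrderIsomorphic⇒SameOrder (m ∷ p) iso Fin.zero    (Fin.suc j) = proj₁ iso j
  OrderIsomorphic⇒SameOrder (m ∷ p) iso (Fin.suc i) Fin.zero    = SameOrder-sym (proj₁ iso i)
  OrderIsomorphic⇒SameOrder (m ∷ p) iso (Fin.suc i) (Fin.suc j) =
    OrderIsomorphic⇒SameOrder p (proj₂ iso) i j

  OrderIsomorphic⇒SameOrderType : ∀ p {f} → OrderIsomorphic p f → SameOrderType f (lookup p)
  OrderIsomorphic⇒SameOrderType p iso =
      (λ i j → SameOrder⇒<⇔< (OrderIsomorphic⇒SameOrder p iso i j))
    , (λ i j → SameOrder⇒≈⇔≡ (OrderIsomorphic⇒SameOrder p iso i j))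

  Occurs : Word → List ℕ → Set (a ⊔ ℓ₁ ⊔ ℓ₂)
  Occurs w p = Σ (Fin (length p) → C) λ f → tabulate f ⊆ w × SameOrderType f (lookup p)

  contains⇒occurs : ∀ {p} → Contains w p → Occurs w p
  contains⇒occurs {w} (α , α↑ , same) = lookup w ∘ α , tabulate-lookup-⊆ w α α↑ , same

  occurs⇒contains : ∀ {p} → Occurs w p → Contains w p
  occurs⇒contains {p = p} (f , f⊆w , same) with α , α↑ , α≗f ← tabulate-⊆⇒embedding f f⊆w =
    α , α↑ , SameOrderType-resp-≗ {g = lookup p} (≡.sym ∘ α≗f) same

  isomorphic-subword⇒contains : ∀ p f → tabulate f ⊆ w → OrderIsomorphic p f → Contains w p
  isomorphic-subword⇒contains p f f⊆w iso =
    occurs⇒contains {p = p} (f , f⊆w , OrderIsomorphic⇒SameOrderType p iso)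

  decreasing⇒isomorphic-decPat : ∀ k {D} → AllPairs _>_ D → k ℕ.< length D →
    Σ (Fin (length (decPat k)) → C) λ f → tabulate f ⊆ D × OrderIsomorphic (decPat k) f
  decreasing⇒isomorphic-decPat zero    {x ∷ D} _ _ = (λ _ → x) , refl ∷ minimum D , (λ ()) , _
  decreasing⇒isomorphic-decPat (suc k) {x ∷ D} (x>D ∷ D↓) (s≤s k<|D|)
    with f , f⊆D , iso ← decreasing⇒isomorphic-decPat k D↓ k<|D| =
    (x ∷ᶠ f) , refl ∷ f⊆D , x>f , iso
    where
    x>f : ∀ j → SameOrder x (f j) (suc k) (lookup (decPat k) j)
    x>f j = both> (All.tabulate⁻ (All-resp-⊆ f⊆D x>D) j) (s≤s (lookup-decPat-≤ k j))

  Sorts-⊆ : ∀ {inp′ st′ out′} → Sorts k inp st out →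
            inp′ ⊆ inp → st′ ⊆ st → out′ ⊆ out → Sorts k inp′ st′ out′
  Sorts-⊆ (done out↑) [] [] out′⊆out =
    done (AllPairs⇒Linked (AllPairs-resp-⊆ out′⊆out (Linked⇒AllPairs ≼.trans out↑)))
  Sorts-⊆ (push _ s) (_ ∷ʳ inp′⊆inp) st′⊆st out′⊆out =
    Sorts-⊆ s inp′⊆inp (_ ∷ʳ st′⊆st) out′⊆out
  Sorts-⊆ (push (R , |R|≤k , covered) s) (refl ∷ inp′⊆inp) st′⊆st out′⊆out =
    push (R , |R|≤k , All-resp-⊆ (refl ∷ st′⊆st) covered) (Sorts-⊆ s inp′⊆inp (refl ∷ st′⊆st) out′⊆out)
  Sorts-⊆ (pop s) inp′⊆inp st′⊆st out′⊆out = pop (Sorts-⊆ s inp′⊆inp [] (++⁺ out′⊆out st′⊆st))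

  Sorts⇒sorted : Sorts k inp st out → AllPairs _≼_ (out ++ st)
  Sorts⇒sorted {out = out} (done out↑) =
    ≡.subst (AllPairs _≼_) (≡.sym (++-identityʳ out)) (Linked⇒AllPairs ≼.trans out↑)
  Sorts⇒sorted {out = out} (push _ s) =
    AllPairs-resp-⊆ (++⁺ (⊆-refl {x = out}) (_ ∷ʳ ⊆-refl)) (Sorts⇒sorted s)
  Sorts⇒sorted {st = st} {out} (pop s) =
    ≡.subst (AllPairs _≼_) (++-identityʳ (out ++ st)) (Sorts⇒sorted s)

  output≼input : Sorts k inp st out → o ∈ out → z ∈ inp → o ≼ z
  output≼input (push _ s) o∈out (here refl)   =
    AllPairs-pair (Sorts⇒sorted s) (++⁺ (from∈ o∈out) (from∈ (here refl)))
  output≼input (push _ s) o∈out (there z∈inp) = output≼input s o∈out z∈inp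
  output≼input (pop s)    o∈out z∈inp         = output≼input s (∈-++⁺ˡ o∈out) z∈inp

  top≼below : Sorts k inp (x ∷ y ∷ st) [] → x ≼ y
  top≼below s = AllPairs-pair (Sorts⇒sorted s) (refl ∷ refl ∷ minimum _)

  ¬sortable-120 : x < y → z < x → ¬ PopStackSortable k (x ∷ y ∷ z ∷ [])
  ¬sortable-120 x<y z<x (pop s)             = ¬sortable-120 x<y z<x s
  ¬sortable-120 x<y z<x (push _ (pop s))    = ≼⇒≯ (output≼input s (here refl) (there (here refl))) z<x
  ¬sortable-120 x<y z<x (push _ (push _ s)) = ≼⇒≯ (top≼below s) x<y

  ¬sortable-201 : y < z → z < x → ¬ PopStackSortable k (x ∷ y ∷ z ∷ [])
  ¬sortable-201 y<z z<x (pop s)                      = ¬sortable-201 y<z z<x s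
  ¬sortable-201 y<z z<x (push _ (pop s))             =
    ≼⇒≯ (output≼input s (here refl) (here refl)) (trans y<z z<x)
  ¬sortable-201 y<z z<x (push _ (push _ (pop s)))    =
    ≼⇒≯ (output≼input s (there (here refl)) (here refl)) z<x
  ¬sortable-201 y<z z<x (push _ (push _ (push _ s))) = ≼⇒≯ (top≼below s) y<z

  ¬sortable-1010 : ∀ {u} → y < x → u < x → y < z → ¬ PopStackSortable k (x ∷ y ∷ z ∷ u ∷ [])
  ¬sortable-1010 y<x u<x y<z (pop s)                      = ¬sortable-1010 y<x u<x y<z s
  ¬sortable-1010 y<x u<x y<z (push _ (pop s))             =
    ≼⇒≯ (output≼input s (here refl) (here refl)) y<x
  ¬sortable-1010 y<x u<x y<z (push _ (push _ (pop s)))    =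
    ≼⇒≯ (output≼input s (there (here refl)) (there (here refl))) u<x
  ¬sortable-1010 y<x u<x y<z (push _ (push _ (push _ s))) = ≼⇒≯ (top≼below s) y<z

  -- The unread input read backwards, followed by the stack read from the top, stays strictly
  -- increasing: a push preserves it, and popping a nonempty stack would output an entry above
  -- the next input. So the last push needs k + 1 distinct values in the stack.
  stack-overflow : ∀ {inp} → Sorts k (x ∷ inp) st out → AllPairs _<_ ((x ∷ inp) ʳ++ st) →
                   k ℕ.< length ((x ∷ inp) ʳ++ st) → ⊥
  stack-overflow {inp = []}    (push (R , |R|≤k , covered) _) ↑ long =
    ℕ.<⇒≱ long (ℕ.≤-trans (pigeonhole Eq.setoid (AllPairs.map (flip irrefl) ↑) covered) |R|≤k)
  stack-overflow {inp = _ ∷ _} (push _ s) ↑ long = stack-overflow s ↑ long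
  stack-overflow {st = []}     (pop s)    ↑ long = stack-overflow s ↑ long
  stack-overflow {st = _ ∷ st} {inp = inp} (pop s) ↑ _ =
    ≼⇒≯ (output≼input s (∈-++⁺ʳ _ (here refl)) (here refl))
        (AllPairs-pair ↑ (ʳ++⁺ (minimum inp) (refl ∷ refl ∷ minimum st)))

  ¬sortable-decreasing : AllPairs _>_ w → k ℕ.< length w → ¬ PopStackSortable k w
  ¬sortable-decreasing {w = x ∷ inp} ↓ long s =
    stack-overflow s (AllPairs-reverse⁺ ↓) (≡.subst (_ ℕ.<_) (≡.sym (length-reverse (x ∷ inp))) long)

  sortable⇒avoids : ∀ p → (∀ {f} → SameOrderType f (lookup p) → ¬ PopStackSortable k (tabulate f)) →
                    PopStackSortable k w → Avoids w p
  sortable⇒avoids p unsortable sortable w∋p with f , f⊆w , same ← contains⇒occurs {p = p} w∋p =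
    unsortable same (Sorts-⊆ sortable f⊆w [] [])

  sortable⇒avoids-120 : PopStackSortable k w → Avoids w (1 ∷ 2 ∷ 0 ∷ [])
  sortable⇒avoids-120 = sortable⇒avoids (1 ∷ 2 ∷ 0 ∷ []) λ same →
    ¬sortable-120 (SameOrderType⇒< same (# 0) (# 1) (ℕ.n<1+n 1)) (SameOrderType⇒< same (# 2) (# 0) ℕ.z<s)

  sortable⇒avoids-201 : PopStackSortable k w → Avoids w (2 ∷ 0 ∷ 1 ∷ [])
  sortable⇒avoids-201 = sortable⇒avoids (2 ∷ 0 ∷ 1 ∷ []) λ same →
    ¬sortable-201 (SameOrderType⇒< same (# 1) (# 2) ℕ.z<s) (SameOrderType⇒< same (# 2) (# 0) (ℕ.n<1+n 1))

  sortable⇒avoids-1010 : PopStackSortable k w → Avoids w (1 ∷ 0 ∷ 1 ∷ 0 ∷ [])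
  sortable⇒avoids-1010 = sortable⇒avoids (1 ∷ 0 ∷ 1 ∷ 0 ∷ []) λ same →
    ¬sortable-1010 (SameOrderType⇒< same (# 1) (# 0) ℕ.z<s) (SameOrderType⇒< same (# 3) (# 0) ℕ.z<s)
                   (SameOrderType⇒< same (# 1) (# 2) ℕ.z<s)

  sortable⇒avoids-decPat : PopStackSortable k w → Avoids w (decPat k)
  sortable⇒avoids-decPat {k} = sortable⇒avoids (decPat k) λ {f} same →
    ¬sortable-decreasing
      (AllPairs.tabulate⁺-< λ {i j} i<j → SameOrderType⇒< same j i (lookup-decPat-decreasing k i j i<j))
      (≡.subst (k ℕ.<_) (≡.sym (≡.trans (length-tabulate f) (length-decPat k))) ℕ.≤-refl)

  _≼*_ : List C → List C → Set (a ⊔ ℓ₁ ⊔ ℓ₂)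
  xs ≼* ys = All (λ x → All (x ≼_) ys) xs

  ≼*-[] : ∀ xs → xs ≼* []
  ≼*-[] = All.universal (λ _ → [])

  prefix-output : ∀ {pre} → Sorts k inp st out → AllPairs _≼_ pre →
                  pre ≼* out → pre ≼* st → pre ≼* inp → Sorts k inp st (pre ++ out)
  prefix-output (done out↑) pre↑ pre≼out _ _ =
    done (AllPairs⇒Linked (AllPairs.++⁺ pre↑ (Linked⇒AllPairs ≼.trans out↑) pre≼out))
  prefix-output (push amd s) pre↑ pre≼out pre≼st pre≼inp =
    push amd (prefix-output s pre↑ pre≼out pre≼x∷st (All.map All.tail pre≼inp))
    where
    pre≼x∷st = All.zipWith (λ (≼inp , ≼st) → All.head ≼inp ∷ ≼st) (pre≼inp , pre≼st)
  prefix-output {k} {inp} {st} {out} {pre} (pop s) pre↑ pre≼out pre≼st pre≼inp =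
    pop (≡.subst (Sorts k inp []) (≡.sym (++-assoc pre out st))
           (prefix-output s pre↑ pre≼out++st (≼*-[] pre) pre≼inp))
    where
    pre≼out++st = All.zipWith (λ (≼out , ≼st) → All.++⁺ ≼out ≼st) (pre≼out , pre≼st)

  dedup : ∀ {xs} → AllPairs _≼_ xs →
          Σ (List C) λ D → D ⊆ xs × AllPairs _<_ D × All (λ x → Any (x ≈_) D) xs
  dedup {[]}         []  = [] , [] , [] , []
  dedup {x ∷ []}     _   = x ∷ [] , ⊆-refl , [] ∷ [] , here Eq.refl ∷ []
  dedup {x ∷ y ∷ xs} ((x≼y ∷ _) ∷ y∷xs↑) with D , D⊆ , D↑ , covered ← dedup y∷xs↑ | x≼y
  ... | inj₂ x≈y = D , x ∷ʳ D⊆ , D↑ , Any.map (Eq.trans x≈y) (All.head covered) ∷ covered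
  ... | inj₁ x<y = x ∷ D , refl ∷ D⊆ , All-resp-⊆ D⊆ x<y∷xs ∷ D↑ , here Eq.refl ∷ All.map there covered
    where
    x<y∷xs = x<y ∷ All.map (<-≼-trans x<y) (AllPairs.head y∷xs↑)

  module Greedy {k} (1≤k : 1 ≤ k) {w : Word}
                (avoids-120 : Avoids w (1 ∷ 2 ∷ 0 ∷ [])) (avoids-201 : Avoids w (2 ∷ 0 ∷ 1 ∷ []))
                (avoids-1010 : Avoids w (1 ∷ 0 ∷ 1 ∷ 0 ∷ [])) (avoids-decPat : Avoids w (decPat k)) where

    no-120 : x ∷ y ∷ z ∷ [] ⊆ w → z < x → x < y → ⊥
    no-120 {x} {y} {z} sub z<x x<y =
      avoids-120 (isomorphic-subword⇒contains (1 ∷ 2 ∷ 0 ∷ []) (lookup (x ∷ y ∷ z ∷ [])) sub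
        ( (λ { Fin.zero → both< x<y (ℕ.n<1+n 1) ; (Fin.suc Fin.zero) → both> z<x ℕ.z<s })
        , (λ { Fin.zero → both> (trans z<x x<y) ℕ.z<s })
        , (λ ()) , _ ))

    no-201 : x ∷ y ∷ z ∷ [] ⊆ w → y < z → z < x → ⊥
    no-201 {x} {y} {z} sub y<z z<x =
      avoids-201 (isomorphic-subword⇒contains (2 ∷ 0 ∷ 1 ∷ []) (lookup (x ∷ y ∷ z ∷ [])) sub
        ( (λ { Fin.zero → both> (trans y<z z<x) ℕ.z<s ; (Fin.suc Fin.zero) → both> z<x (ℕ.n<1+n 1) })
        , (λ { Fin.zero → both< y<z ℕ.z<s })
        , (λ ()) , _ ))

    no-1010 : ∀ {u} → x ∷ y ∷ z ∷ u ∷ [] ⊆ w → y < x → x ≈ z → y ≈ u → ⊥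
    no-1010 {x} {y} {z} {u} sub y<x x≈z y≈u =
      avoids-1010 (isomorphic-subword⇒contains (1 ∷ 0 ∷ 1 ∷ 0 ∷ []) (lookup (x ∷ y ∷ z ∷ u ∷ [])) sub
        ( (λ { Fin.zero → both> y<x ℕ.z<s ; (Fin.suc Fin.zero) → both≈ x≈z refl
             ; (Fin.suc (Fin.suc Fin.zero)) → both> u<x ℕ.z<s })
        , (λ { Fin.zero → both< y<z ℕ.z<s ; (Fin.suc Fin.zero) → both≈ y≈u refl })
        , (λ { Fin.zero → both> (proj₁ <-resp-≈ x≈z u<x) ℕ.z<s })
        , (λ ()) , _ ))
      where
      y<z = proj₁ <-resp-≈ x≈z y<x
      u<x = proj₂ <-resp-≈ y≈u y<x

    no-long-decreasing : ∀ {D} → D ⊆ w → AllPairs _>_ D → k ℕ.< length D → ⊥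
    no-long-decreasing D⊆w D↓ long with f , f⊆D , iso ← decreasing⇒isomorphic-decPat k D↓ long =
      avoids-decPat (isomorphic-subword⇒contains (decPat k) f (⊆-trans f⊆D D⊆w) iso)

    ascent-blocks-descent : o ∷ b ∷ y ∷ z ∷ [] ⊆ w → b < y → ¬ z < o
    ascent-blocks-descent {o} {b} {y} {z} sub b<y z<o with compare o y
    ... | tri< o<y _ _ = no-120 (⊆-trans (refl ∷ b ∷ʳ ⊆-refl) sub) z<o o<y
    ... | tri> _ _ y<o = no-201 (⊆-trans (refl ∷ refl ∷ refl ∷ z ∷ʳ []) sub) b<y y<o
    ... | tri≈ _ o≈y _ with compare b z
    ...   | tri< b<z _ _ = no-201 (⊆-trans (refl ∷ refl ∷ y ∷ʳ refl ∷ []) sub) b<z z<o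
    ...   | tri≈ _ b≈z _ = no-1010 sub (proj₁ <-resp-≈ (Eq.sym o≈y) b<y) o≈y b≈z
    ...   | tri> _ _ z<b = no-120 (⊆-trans (o ∷ʳ ⊆-refl) sub) z<b b<y

    top≼unread : ∀ {rest} → b ∷ y ∷ rest ⊆ w → b < y → z ∈ y ∷ rest → b ≼ z
    top≼unread sub b<y (here refl)    = inj₁ b<y
    top≼unread sub b<y (there z∈rest) =
      ≮⇒≽ (λ z<b → no-120 (⊆-trans (refl ∷ refl ∷ from∈ z∈rest) sub) z<b b<y)

    deeper≼unread : ∀ {rest} → o ∷ b ∷ y ∷ rest ⊆ w → b < y → z ∈ y ∷ rest → o ≼ z
    deeper≼unread {rest = rest} sub b<y (here refl)    =
      ≮⇒≽ (no-201 (⊆-trans (refl ∷ refl ∷ refl ∷ minimum rest) sub) b<y)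
    deeper≼unread               sub b<y (there z∈rest) =
      ≮⇒≽ (ascent-blocks-descent (⊆-trans (refl ∷ refl ∷ refl ∷ from∈ z∈rest) sub) b<y)

    stack≼unread : ∀ {rest} → (b ∷ st) ʳ++ (y ∷ rest) ⊆ w → b < y → (b ∷ st) ≼* (y ∷ rest)
    stack≼unread {st = st} sub b<y = All.tabulate λ
      { (here refl)  → All.tabulate (top≼unread (⊆-trans (ʳ++⁺ (minimum st) ⊆-refl) sub) b<y)
      ; (there o∈st) → All.tabulate (deeper≼unread (⊆-trans (ʳ++⁺ (from∈ o∈st) ⊆-refl) sub) b<y) }

    stack-bounded : ∀ {rest} → AllPairs _≼_ st → st ʳ++ rest ⊆ w → AtMostDistinct k st
    stack-bounded st↑ sub with D , D⊆st , D↑ , covered ← dedup st↑ with length D ℕ.≤? k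
    ... | yes |D|≤k = D , |D|≤k , covered
    ... | no  |D|≰k = ⊥-elim (no-long-decreasing (⊆-trans (ʳ++⁺ D⊆st (minimum _)) sub)
                                                 (AllPairs-reverse⁺ D↑)
                                                 (≡.subst (k ℕ.<_) (≡.sym (length-reverse D)) (ℕ.≰⇒> |D|≰k)))

    mutual
      sort-run : ∀ rest st → AllPairs _≼_ st → st ʳ++ rest ⊆ w → Sorts k rest st []
      sort-run []         st       st↑ _   = pop (done (AllPairs⇒Linked st↑))
      sort-run (y ∷ rest) []       _   sub = sort-new-run y rest sub
      sort-run (y ∷ rest) (b ∷ st) st↑ sub with b <? y
      ... | no  b≮y = push (stack-bounded y∷st↑ sub) (sort-run rest (y ∷ b ∷ st) y∷st↑ sub)
        where
        y≼b = ≮⇒≽ b≮y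
        y∷st↑ = (y≼b ∷ All.map (≼.trans y≼b) (AllPairs.head st↑)) ∷ st↑
      ... | yes b<y = pop (≡.subst (Sorts k (y ∷ rest) []) (++-identityʳ (b ∷ st))
                             (prefix-output (sort-new-run y rest y∷rest⊆w) st↑ (≼*-[] _) (≼*-[] _)
                                            (stack≼unread sub b<y)))
        where
        y∷rest⊆w = ⊆-trans (ʳ++⁺ (minimum (b ∷ st)) ⊆-refl) sub

      sort-new-run : ∀ y rest → y ∷ rest ⊆ w → Sorts k (y ∷ rest) [] []
      sort-new-run y rest sub =
        push (y ∷ [] , 1≤k , here Eq.refl ∷ []) (sort-run rest (y ∷ []) ([] ∷ []) sub)

    sortable : PopStackSortable k w
    sortable = sort-run w [] [] ⊆-refl

mainTheorem9 : ∀ {a ℓ₁ ℓ₂ : Level} (O : StrictTotalOrder a ℓ₁ ℓ₂) (k : ℕ) → 1 ≤ k →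
    (w : List (StrictTotalOrder.Carrier O)) →
    PopStack.PopStackSortable O k w ⇔
      (PopStack.Avoids O w (1 ∷ 2 ∷ 0 ∷ [])
       × PopStack.Avoids O w (2 ∷ 0 ∷ 1 ∷ [])
       × PopStack.Avoids O w (1 ∷ 0 ∷ 1 ∷ 0 ∷ [])
       × PopStack.Avoids O w (decPat k))
mainTheorem9 O k 1≤k w = mk⇔
  (λ sortable → sortable⇒avoids-120 O sortable , sortable⇒avoids-201 O sortable
              , sortable⇒avoids-1010 O sortable , sortable⇒avoids-decPat O sortable)
  (λ (avoids-120 , avoids-201 , avoids-1010 , avoids-decPat) →
     Greedy.sortable O 1≤k avoids-120 avoids-201 avoids-1010 avoids-decPat)
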